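{- Let $e,k$ be positive integers, $q=2^e$, and $V=\mathbb{F}_{q^{2k+1}}\times\mathbb{F}_q$, viewed as a vector space over $\mathbb{F}_q$, with vectors written $\overline{x}=(x,x_1)$, $x\in\mathbb{F}_{q^{2k+1}}$, $x_1\in\mathbb{F}_q$. Define $g:V\times V\to\mathbb{F}_{q^{2k+1}}$ by $$g(\overline{x},\overline{y})=(x_1y+y_1x)^{q+1}+xy^q+x^qy.$$ Let $\overline{x}=(x,x_1),\overline{y}=(y,y_1)\in V$ be linearly independent over $\mathbb{F}_q$ and let $S$ be their span. Then for every $\overline{z},\overline{w}\in S$, $$g(\overline{z},\overline{w})\in E:=\{\alpha^2(x_1y+y_1x)^{q+1}+\alpha(xy^q+x^qy):\alpha\in\mathbb{F}_q\}.$$ -}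

module Defs where

open import Level using (_⊔_)
open import Data.Nat using (ℕ; zero; suc)
open import Data.Fin using (Fin)
open import Data.Product using (_×_; _,_; ∃; proj₁; proj₂)
open import Algebra.Bundles using (CommutativeRing)
open import Function.Bundles using (Inverse)
open import Relation.Binary.PropositionalEquality as ≡ using ()
open import Relation.Nullary using (¬_)

module _ {c ℓ} (F : CommutativeRing c ℓ) where
  open CommutativeRing F

  pow : Carrier → ℕ → Carrier
  pow x zero    = 1#
  pow x (suc n) = x * pow x n

  IsField : Set (c ⊔ ℓ)
  IsField = (¬ (1# ≈ 0#)) × (∀ x → ¬ (x ≈ 0#) → ∃ λ y → x * y ≈ 1#)

  HasCardinality : ℕ → Set (c ⊔ ℓ)
  HasCardinality N = Inverse (≡.setoid (Fin N)) setoid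

  -- membership in the subfield F_q of F_{q^n}: the fixed points of x ↦ x^q
  InSub : ℕ → Carrier → Set ℓ
  InSub q a = pow a q ≈ a

  -- vectors of V = F_{q^{2k+1}} × F_q are pairs (x , x₁) with x₁ ∈ F_q
  InV : ℕ → Carrier × Carrier → Set ℓ
  InV q (x , x₁) = InSub q x₁

  scale : Carrier → Carrier × Carrier → Carrier × Carrier
  scale a (x , x₁) = (a * x , a * x₁)

  addV : Carrier × Carrier → Carrier × Carrier → Carrier × Carrier
  addV (x , x₁) (y , y₁) = (x + y , x₁ + y₁)

  _≈V_ : Carrier × Carrier → Carrier × Carrier → Set ℓ
  (x , x₁) ≈V (y , y₁) = (x ≈ y) × (x₁ ≈ y₁)

  zeroV : Carrier × Carrier
  zeroV = (0# , 0#)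

  LinIndep : ℕ → Carrier × Carrier → Carrier × Carrier → Set (c ⊔ ℓ)
  LinIndep q u v = ∀ a b → InSub q a → InSub q b →
    addV (scale a u) (scale b v) ≈V zeroV → (a ≈ 0#) × (b ≈ 0#)

  InSpan : ℕ → Carrier × Carrier → Carrier × Carrier → Carrier × Carrier → Set (c ⊔ ℓ)
  InSpan q u v z = ∃ λ a → ∃ λ b → InSub q a × InSub q b × (z ≈V addV (scale a u) (scale b v))

  g : ℕ → Carrier × Carrier → Carrier × Carrier → Carrier
  g q (x , x₁) (y , y₁) = pow (x₁ * y + y₁ * x) (suc q) + (x * pow y q + pow x q * y)

  InE : ℕ → Carrier × Carrier → Carrier × Carrier → Carrier → Set (c ⊔ ℓ)
  InE q (x , x₁) (y , y₁) t = ∃ λ α → InSub q α ×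
    (t ≈ pow α 2 * pow (x₁ * y + y₁ * x) (suc q) + α * (x * pow y q + pow x q * y))

{-# OPTIONS --safe #-}
module Submission where

-- Write z̄ = a x̄ + b ȳ and w̄ = c x̄ + d ȳ with a, b, c, d ∈ F_q. A field of
-- order 2^{e(2k+1)} has characteristic 2, so x ↦ x^q is F_q-linear, and both
-- (z̄, w̄) ↦ z₁w + w₁z and (z̄, w̄) ↦ z w^q + z^q w are symmetric F_q-bilinear
-- forms vanishing on the diagonal. On the span of x̄, ȳ each is therefore the
-- determinant α = ad + bc times its value at (x̄, ȳ). As α ∈ F_q we have
-- α^{q+1} = α², so g(z̄, w̄) is the element of E with parameter α.

open import Defs
open import Algebra.Bundles using (CommutativeRing)
import Algebra.Properties.CommutativeMonoid.Sum as CommutativeMonoidSum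
import Algebra.Properties.CommutativeSemiring.Exp as CommutativeSemiringExp
import Algebra.Properties.Group as GroupProperties
import Algebra.Properties.Semiring.Mult as SemiringMult
open import Data.Empty using (⊥-elim)
open import Data.Fin using (Fin)
open import Data.Fin.Permutation using (Permutation′; permutation)
import Data.Fin.Properties as Fin
open import Data.Maybe using (nothing)
import Data.Nat as ℕ
import Data.Nat.Properties as ℕ
open import Data.Product using (_,_; proj₁; proj₂)
open import Data.Sum using (_⊎_; inj₁; inj₂; [_,_])
open import Data.Vec.Functional using (replicate)
open import Function using (id)
open import Function.Bundles using (Inverse)
open import Relation.Binary.Definitions using (Decidable)
import Relation.Binary.PropositionalEquality as ≡
open import Relation.Nullary.Decidable using (map′; yes; no)
open import Tactic.RingSolver.Core.AlmostCommutativeRing using (fromCommutativeRing)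
import Tactic.RingSolver.NonReflective as RingSolver

module _ {c ℓ} (F : CommutativeRing c ℓ) where
  open CommutativeRing F
  open CommutativeSemiringExp commutativeSemiring using (_^_; ^-congˡ; ^-assocʳ; ^-distrib-*)
  open SemiringMult semiring using (_×_; ×-congʳ; ×-assoc-*; ×1-homo-*)
  open RingSolver (fromCommutativeRing F (λ _ → nothing)) using (solve; _⊜_; _⊕_; _⊗_; Κ)
  open import Relation.Binary.Reasoning.Setoid setoid

  module _ {N : ℕ.ℕ} (card : HasCardinality F N) where
    open Inverse card
    open CommutativeMonoidSum +-commutativeMonoid
      using (sum; sum-permute; sum-cong-≋; ∑-distrib-+; sum-replicate)
    open GroupProperties +-group using (//-rightDividesˡ; //-rightDividesʳ; identityʳ-unique)

    ≈-dec : Decidable _≈_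
    ≈-dec x y = map′ from-injective from-cong (from x Fin.≟ from y)
      where
      from-injective : from x ≡.≡ from y → x ≈ y
      from-injective p = trans (sym (strictlyInverseˡ x)) (trans (to-cong p) (strictlyInverseˡ y))

    shift : Carrier → Fin N → Fin N
    shift x i = from (to i + x)

    shift-shift : ∀ x y → (∀ t → t + x + y ≈ t) → ∀ i → shift y (shift x i) ≡.≡ i
    shift-shift x y cancel i =
      ≡.trans (from-cong (trans (+-congʳ (strictlyInverseˡ (to i + x))) (cancel (to i)))) (strictlyInverseʳ i)

    translation : Carrier → Permutation′ N
    translation x = permutation (shift x) (shift (- x))
      (shift-shift (- x) x (//-rightDividesˡ x)) (shift-shift x (- x) (//-rightDividesʳ x))

    -- Translating by x permutes F, so Σ_F t = Σ_F (t + x) = Σ_F t + N·x.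
    card×≈0 : ∀ x → N × x ≈ 0#
    card×≈0 x = identityʳ-unique (sum to) (N × x) (sym (begin
      sum to                              ≈⟨ sum-permute to (translation x) ⟩
      sum (λ i → to (shift x i))          ≈⟨ sum-cong-≋ (λ i → strictlyInverseˡ (to i + x)) ⟩
      sum (λ i → to i + x)                ≈⟨ ∑-distrib-+ to (λ _ → x) ⟩
      sum to + sum (replicate N x)        ≈⟨ +-congˡ (sum-replicate N) ⟩
      sum to + N × x                      ∎))

  module _ (isField : IsField F) (_≟_ : Decidable _≈_) where

    x*y≈0⇒x≈0⊎y≈0 : ∀ {x y} → x * y ≈ 0# → x ≈ 0# ⊎ y ≈ 0#
    x*y≈0⇒x≈0⊎y≈0 {x} {y} xy≈0 with x ≟ 0#
    ... | yes x≈0 = inj₁ x≈0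
    ... | no x≉0  with proj₂ isField x x≉0
    ... | x⁻¹ , xx⁻¹≈1 = inj₂ (begin
      y               ≈⟨ *-identityˡ y ⟨
      1# * y          ≈⟨ *-congʳ (trans (*-comm x⁻¹ x) xx⁻¹≈1) ⟨
      x⁻¹ * x * y     ≈⟨ *-assoc x⁻¹ x y ⟩
      x⁻¹ * (x * y)   ≈⟨ *-congˡ xy≈0 ⟩
      x⁻¹ * 0#        ≈⟨ zeroʳ x⁻¹ ⟩
      0#              ∎)

    x^n≈0⇒x≈0 : ∀ {x} n → x ^ n ≈ 0# → x ≈ 0#
    x^n≈0⇒x≈0 ℕ.zero    1≈0   = ⊥-elim (proj₁ isField 1≈0)
    x^n≈0⇒x≈0 (ℕ.suc n) xxⁿ≈0 = [ id , x^n≈0⇒x≈0 n ] (x*y≈0⇒x≈0⊎y≈0 xxⁿ≈0)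

  ×1-homo-^ : ∀ m n → (m ℕ.^ n) × 1# ≈ (m × 1#) ^ n
  ×1-homo-^ m ℕ.zero    = +-identityʳ 1#
  ×1-homo-^ m (ℕ.suc n) = trans (×1-homo-* m (m ℕ.^ n)) (*-congˡ (×1-homo-^ m n))

  characteristic-two : ∀ n → IsField F → HasCardinality F (2 ℕ.^ n) → ∀ x → x + x ≈ 0#
  characteristic-two n isField card x = begin
    x + x           ≈⟨ +-congˡ (+-identityʳ x) ⟨
    x + (x + 0#)    ≈⟨ ×-congʳ 2 (*-identityˡ x) ⟨
    2 × (1# * x)    ≈⟨ ×-assoc-* 2 1# x ⟨
    (2 × 1#) * x    ≈⟨ *-congʳ two≈0 ⟩
    0# * x          ≈⟨ zeroˡ x ⟩
    0#              ∎
    where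
    two≈0 : 2 × 1# ≈ 0#
    two≈0 = x^n≈0⇒x≈0 isField (≈-dec card) n (trans (sym (×1-homo-^ 2 n)) (card×≈0 card 1#))

  pow≡^ : ∀ x n → pow F x n ≡.≡ x ^ n
  pow≡^ x ℕ.zero    = ≡.refl
  pow≡^ x (ℕ.suc n) = ≡.cong (x *_) (pow≡^ x n)

  pow-cong : ∀ {x y} n → x ≈ y → pow F x n ≈ pow F y n
  pow-cong {x} {y} n x≈y rewrite pow≡^ x n | pow≡^ y n = ^-congˡ n x≈y

  pow-distrib-* : ∀ x y n → pow F (x * y) n ≈ pow F x n * pow F y n
  pow-distrib-* x y n rewrite pow≡^ (x * y) n | pow≡^ x n | pow≡^ y n = ^-distrib-* x y n

  module _ (x+x≈0 : ∀ x → x + x ≈ 0#) where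

    square-+ : ∀ u v → (u + v) ^ 2 ≈ u ^ 2 + v ^ 2
    square-+ u v = begin
      (u + v) ^ 2                          ≈⟨ x^2≈x*x (u + v) ⟩
      (u + v) * (u + v)                    ≈⟨ expand u v ⟩
      u * u + v * v + (u * v + u * v)      ≈⟨ +-congˡ (x+x≈0 (u * v)) ⟩
      u * u + v * v + 0#                   ≈⟨ +-identityʳ _ ⟩
      u * u + v * v                        ≈⟨ +-cong (x^2≈x*x u) (x^2≈x*x v) ⟨
      u ^ 2 + v ^ 2                        ∎
      where
      x^2≈x*x : ∀ x → x ^ 2 ≈ x * x
      x^2≈x*x x = *-congˡ (*-identityʳ x)

      expand : ∀ u v → (u + v) * (u + v) ≈ u * u + v * v + (u * v + u * v)
      expand = solve 2 (λ u v → ((u ⊕ v) ⊗ (u ⊕ v)) ⊜ ((u ⊗ u ⊕ v ⊗ v) ⊕ (u ⊗ v ⊕ u ⊗ v))) refl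

    frobenius : ∀ e u v → (u + v) ^ (2 ℕ.^ e) ≈ u ^ (2 ℕ.^ e) + v ^ (2 ℕ.^ e)
    frobenius ℕ.zero    u v = trans (*-identityʳ (u + v)) (sym (+-cong (*-identityʳ u) (*-identityʳ v)))
    frobenius (ℕ.suc e) u v = begin
      (u + v) ^ (2 ℕ.* q)                  ≈⟨ ^-assocʳ (u + v) 2 q ⟨
      ((u + v) ^ 2) ^ q                    ≈⟨ ^-congˡ q (square-+ u v) ⟩
      (u ^ 2 + v ^ 2) ^ q                  ≈⟨ frobenius e (u ^ 2) (v ^ 2) ⟩
      (u ^ 2) ^ q + (v ^ 2) ^ q            ≈⟨ +-cong (^-assocʳ u 2 q) (^-assocʳ v 2 q) ⟩
      u ^ (2 ℕ.* q) + v ^ (2 ℕ.* q)        ∎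
      where
      q : ℕ.ℕ
      q = 2 ℕ.^ e

    -- In characteristic 2 the form p r′ + r p′ is alternating: the a c and b d
    -- terms come out doubled, so only the determinant a d + b c survives.
    bilinear-on-span : ∀ a b c d p r p′ r′ →
      (a * p + b * r) * (c * p′ + d * r′) + (c * p + d * r) * (a * p′ + b * r′)
        ≈ (a * d + b * c) * (p * r′ + r * p′)
    bilinear-on-span a b c d p r p′ r′ = begin
      (a * p + b * r) * (c * p′ + d * r′) + (c * p + d * r) * (a * p′ + b * r′)
        ≈⟨ expand a b c d p r p′ r′ ⟩
      (a * d + b * c) * (p * r′ + r * p′) + (ac + ac) + (bd + bd)
        ≈⟨ +-cong (+-congˡ (x+x≈0 ac)) (x+x≈0 bd) ⟩
      (a * d + b * c) * (p * r′ + r * p′) + 0# + 0#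
        ≈⟨ trans (+-identityʳ _) (+-identityʳ _) ⟩
      (a * d + b * c) * (p * r′ + r * p′) ∎
      where
      ac bd : Carrier
      ac = a * c * (p * p′)
      bd = b * d * (r * r′)
      expand : ∀ a b c d p r p′ r′ →
        (a * p + b * r) * (c * p′ + d * r′) + (c * p + d * r) * (a * p′ + b * r′)
          ≈ (a * d + b * c) * (p * r′ + r * p′)
            + (a * c * (p * p′) + a * c * (p * p′)) + (b * d * (r * r′) + b * d * (r * r′))
      expand = solve 8 (λ a b c d p r p′ r′ →
        (((a ⊗ p ⊕ b ⊗ r) ⊗ (c ⊗ p′ ⊕ d ⊗ r′)) ⊕ ((c ⊗ p ⊕ d ⊗ r) ⊗ (a ⊗ p′ ⊕ b ⊗ r′)))
          ⊜ ((((a ⊗ d ⊕ b ⊗ c) ⊗ (p ⊗ r′ ⊕ r ⊗ p′))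
            ⊕ ((a ⊗ c) ⊗ (p ⊗ p′) ⊕ (a ⊗ c) ⊗ (p ⊗ p′)))
            ⊕ ((b ⊗ d) ⊗ (r ⊗ r′) ⊕ (b ⊗ d) ⊗ (r ⊗ r′)))) refl

    module _ (e : ℕ.ℕ) where
      private
        q : ℕ.ℕ
        q = 2 ℕ.^ e

      pow-frobenius : ∀ u v → pow F (u + v) q ≈ pow F u q + pow F v q
      pow-frobenius u v rewrite pow≡^ (u + v) q | pow≡^ u q | pow≡^ v q = frobenius e u v

      InSub-+ : ∀ {a b} → InSub F q a → InSub F q b → InSub F q (a + b)
      InSub-+ {a} {b} a∈ b∈ = trans (pow-frobenius a b) (+-cong a∈ b∈)

      InSub-* : ∀ {a b} → InSub F q a → InSub F q b → InSub F q (a * b)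
      InSub-* {a} {b} a∈ b∈ = trans (pow-distrib-* a b q) (*-cong a∈ b∈)

      pow-linear : ∀ {a b} → InSub F q a → InSub F q b →
                   ∀ u v → pow F (a * u + b * v) q ≈ a * pow F u q + b * pow F v q
      pow-linear {a} {b} a∈ b∈ u v = trans (pow-frobenius (a * u) (b * v))
        (+-cong (trans (pow-distrib-* a u q) (*-congʳ a∈)) (trans (pow-distrib-* b v q) (*-congʳ b∈)))

      InSub⇒pow-suc≈pow-2 : ∀ {a} → InSub F q a → pow F a (ℕ.suc q) ≈ pow F a 2
      InSub⇒pow-suc≈pow-2 {a} a∈ = *-congˡ (trans a∈ (sym (*-identityʳ a)))

      g-on-span : ∀ xb yb zb wb → InSpan F q xb yb zb → InSpan F q xb yb wb →
                  InE F q xb yb (g F q zb wb)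
      g-on-span (x , x₁) (y , y₁) (z , z₁) (w , w₁)
                (a , b , a∈ , b∈ , z≈ , z₁≈) (c , d , c∈ , d∈ , w≈ , w₁≈) =
        α , α∈ , (begin
          pow F (z₁ * w + w₁ * z) (ℕ.suc q) + (z * pow F w q + pow F z q * w)
            ≈⟨ +-cong (pow-cong (ℕ.suc q) first-form) second-form ⟩
          pow F (α * D) (ℕ.suc q) + α * T
            ≈⟨ +-congʳ (pow-distrib-* α D (ℕ.suc q)) ⟩
          pow F α (ℕ.suc q) * pow F D (ℕ.suc q) + α * T
            ≈⟨ +-congʳ (*-congʳ (InSub⇒pow-suc≈pow-2 α∈)) ⟩
          pow F α 2 * pow F D (ℕ.suc q) + α * T ∎)
        where
        α D X Y T : Carrier
        α = a * d + b * c
        D = x₁ * y + y₁ * x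
        X = pow F x q
        Y = pow F y q
        T = x * Y + X * y

        α∈ : InSub F q α
        α∈ = InSub-+ (InSub-* a∈ d∈) (InSub-* b∈ c∈)

        first-form : z₁ * w + w₁ * z ≈ α * D
        first-form = trans (+-cong (*-cong z₁≈ w≈) (*-cong w₁≈ z≈)) (bilinear-on-span a b c d x₁ y₁ x y)

        second-form : z * pow F w q + pow F z q * w ≈ α * T
        second-form = begin
          z * pow F w q + pow F z q * w
            ≈⟨ +-cong (*-cong z≈ (trans (pow-cong q w≈) (pow-linear c∈ d∈ x y)))
                      (trans (*-comm _ w) (*-cong w≈ (trans (pow-cong q z≈) (pow-linear a∈ b∈ x y)))) ⟩
          (a * x + b * y) * (c * X + d * Y) + (c * x + d * y) * (a * X + b * Y)
            ≈⟨ bilinear-on-span a b c d x y X Y ⟩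
          α * (x * Y + y * X)
            ≈⟨ *-congˡ (+-congˡ (*-comm y X)) ⟩
          α * T ∎

open import Data.Nat using (ℕ; suc; _+_; _*_; _^_; _≤_)
open import Data.Product using (_×_)

lemma3p1 : ∀ {c ℓ} (e k : ℕ) (F : CommutativeRing c ℓ) →
    1 ≤ e → 1 ≤ k →
    IsField F → HasCardinality F ((2 ^ e) ^ (2 * k + 1)) →
    ∀ (xb yb : CommutativeRing.Carrier F × CommutativeRing.Carrier F) →
    InV F (2 ^ e) xb → InV F (2 ^ e) yb →
    LinIndep F (2 ^ e) xb yb →
    ∀ zb wb → InV F (2 ^ e) zb → InV F (2 ^ e) wb →
    InSpan F (2 ^ e) xb yb zb → InSpan F (2 ^ e) xb yb wb →
    InE F (2 ^ e) xb yb (g F (2 ^ e) zb wb)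
lemma3p1 e k F _ _ isField card xb yb _ _ _ zb wb _ _ z∈S w∈S =
  g-on-span F (characteristic-two F (e * (2 * k + 1)) isField card′) e xb yb zb wb z∈S w∈S
  where
  card′ : HasCardinality F (2 ^ (e * (2 * k + 1)))
  card′ = ≡.subst (HasCardinality F) (ℕ.^-*-assoc 2 e (2 * k + 1)) card
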